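{- Let $a_1,a_2,p,q,r,s\ge 2$ be integers with $r<s$, $\gcd(qs,qr,rs)=1$ and $\gcd(p,r)=\gcd(p,s)=\gcd(r,s)=1$. Then the rectangle $(a_1\times a_2)$ can be tiled with the bricks $(p\times q)$ and $(r\times s)$ if $$a_1,a_2\ge \max\{2qrs-(qs+qr+rs)+1,\ (p-1)(s-1),\ (r-1)(s-1)\}.$$
   Context: $(a_1\times a_2)$ denotes the rectangle $[0,a_1]\times[0,a_2]\subseteq\mathbb{R}^2$. A rectangle is tiled with bricks $B_1,\dots,B_k$ if it is the union of finitely many copies of the $B_i$ (translated, and rotations allowed) with pairwise disjoint interiors. -}

module Defs where

open import Data.Nat using (ℕ; _+_; _≤_; _<_)
open import Data.Nat.Base using (_≤ᵇ_; _<ᵇ_)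
open import Data.Bool using (Bool; _∧_; if_then_else_)
open import Data.List using (List; map)
open import Data.Nat.ListAction using (sum)
open import Data.List.Relation.Unary.All using (All)
open import Data.Product using (_×_; Σ; _,_)
open import Data.Sum using (_⊎_)
open import Relation.Binary.PropositionalEquality using (_≡_)

-- A brick (w × h) placed axis-parallel with its lower-left corner at the
-- integer point (x , y): it occupies [x, x+w] × [y, y+h].
record Placed : Set where
  constructor place
  field
    x y w h : ℕ

open Placed public

IsCopyOf : ℕ → ℕ → Placed → Set
IsCopyOf p q b = (w b ≡ p × h b ≡ q) ⊎ (w b ≡ q × h b ≡ p)

Inside : ℕ → ℕ → Placed → Set
Inside a₁ a₂ b = (x b + w b ≤ a₁) × (y b + h b ≤ a₂)

-- Does the placed brick contain the unit cell [i,i+1] × [j,j+1] ?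
covers : Placed → ℕ → ℕ → Bool
covers b i j = (x b ≤ᵇ i) ∧ (i <ᵇ x b + w b) ∧ (y b ≤ᵇ j) ∧ (j <ᵇ y b + h b)

coverCount : List Placed → ℕ → ℕ → ℕ
coverCount bs i j = sum (map (λ b → if covers b i j then 1 else 0) bs)

-- A tiling of (a₁ × a₂) by the bricks (p × q) and (r × s): a finite list of
-- placed copies, each inside the rectangle, such that every unit cell of the
-- rectangle is covered by exactly one brick (union = rectangle, pairwise
-- disjoint interiors).
IsTiling : ℕ → ℕ → ℕ → ℕ → ℕ → ℕ → List Placed → Set
IsTiling a₁ a₂ p q r s bs =
  All (λ b → (IsCopyOf p q b ⊎ IsCopyOf r s b) × Inside a₁ a₂ b) bs
  × (∀ i j → i < a₁ → j < a₂ → coverCount bs i j ≡ 1)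

Tileable : ℕ → ℕ → ℕ → ℕ → ℕ → ℕ → Set
Tileable a₁ a₂ p q r s = Σ (List Placed) (IsTiling a₁ a₂ p q r s)

module Submission where

-- Since gcd(q, rs) = gcd(r, s) = 1, every a₁ above the Frobenius number 2qrs − qs − qr − rs
-- of {rs, qr, qs} is x·rs + y·qr + z·qs: take x < q with x·rs ≡ a₁ (mod q), and write
-- k = (a₁ − x·rs)/q, which exceeds rs − r − s, as y·r + z·s by Sylvester's two-coin theorem.
-- So the rectangle splits into vertical strips of widths rs, qr and qs. A strip of width rs
-- is a stack of bands of height r (r bricks s × r) and s (s bricks r × s); likewise strips of
-- width qr and qs stack bands of heights p and s, resp. p and r. Every height a₂ above
-- (p − 1)(s − 1) and (r − 1)(s − 1) is such a sum, again by Sylvester, as r < s.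

open import Defs
open import Data.Nat using (ℕ; _+_; _*_; _∸_; _≤_; _<_; _⊔_)
open import Data.Nat.GCD using (gcd)
open import Relation.Binary.PropositionalEquality using (_≡_)

open import Data.Bool using (true; false; _∧_; if_then_else_)
open import Data.Bool.Properties using (∧-assoc; ∧-comm; ∧-zeroʳ)
open import Data.Empty using (⊥)
open import Data.List using (_∷_; []; _++_; map)
open import Data.List.Properties using (map-++)
import Data.List.Relation.Unary.All as All
open All using (All; []; _∷_)
open import Data.List.Relation.Unary.All.Properties using (++⁺; map⁺)
open import Data.Nat
open import Data.Nat.Coprimality using (coprime-Bézout; gcd≡1⇒coprime)
open import Data.Nat.DivMod
open import Data.Nat.Divisibility using (_∣_; ∣-trans; m∣m*n; ∣1⇒≡1)
open import Data.Nat.GCD using (gcd-comm; gcd[m,n]∣m; gcd[m,n]∣n; gcd-greatest; module Bézout)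
open import Data.Nat.ListAction using (sum)
open import Data.Nat.ListAction.Properties using (sum-++)
open import Data.Nat.Properties
open import Data.Nat.Tactic.RingSolver using (solve-∀)
open import Data.Product using (_×_; _,_; ∃-syntax)
import Data.Product as Prod
open import Data.Sum using (_⊎_; inj₁; inj₂)
open import Relation.Nullary using (yes; no)
open import Relation.Binary.PropositionalEquality

-- Representations as nonnegative combinations

%-cong-*ʳ : ∀ {m n} c d .{{_ : NonZero d}} → m % d ≡ n % d → (m * c) % d ≡ (n * c) % d
%-cong-*ʳ {m} {n} c d m≡n = begin
  (m * c) % d                 ≡⟨ %-distribˡ-* m c d ⟩
  ((m % d) * (c % d)) % d     ≡⟨ cong (λ t → (t * (c % d)) % d) m≡n ⟩
  ((n % d) * (c % d)) % d     ≡⟨ %-distribˡ-* n c d ⟨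
  (n * c) % d                 ∎
  where open ≡-Reasoning

∃-inverse-mod : ∀ c d .{{_ : NonZero d}} → gcd c d ≡ 1 → ∃[ u ] (u * c) % d ≡ 1 % d
∃-inverse-mod c d gcd≡1 with coprime-Bézout (gcd≡1⇒coprime gcd≡1)
... | Bézout.+- u v 1+vd≡uc = u , (begin
  (u * c) % d     ≡⟨ cong (_% d) 1+vd≡uc ⟨
  (1 + v * d) % d ≡⟨ [m+kn]%n≡m%n 1 v d ⟩
  1 % d           ∎)
  where open ≡-Reasoning
-- Here u * c ≡ -1 (mod d), so u * (d - 1) is an inverse.
... | Bézout.-+ u v 1+uc≡vd = u * pred d , (begin
  (u * pred d * c) % d             ≡⟨ [m+kn]%n≡m%n (u * pred d * c) v d ⟨
  (u * pred d * c + v * d) % d     ≡⟨ cong (_% d) (cong (u * pred d * c +_) 1+uc≡vd) ⟨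
  (u * pred d * c + (1 + u * c)) % d ≡⟨ cong (_% d) (identity u c (pred d)) ⟩
  (1 + u * c * suc (pred d)) % d   ≡⟨ cong (λ t → (1 + u * c * t) % d) (suc-pred d) ⟩
  (1 + u * c * d) % d              ≡⟨ [m+kn]%n≡m%n 1 (u * c) d ⟩
  1 % d                            ∎)
  where
  open ≡-Reasoning
  identity : ∀ u c d′ → u * d′ * c + (1 + u * c) ≡ 1 + u * c * suc d′
  identity = solve-∀

∃-multiple≡-mod : ∀ c d .{{_ : NonZero d}} → gcd c d ≡ 1 → ∀ m → ∃[ x ] x < d × (x * c) % d ≡ m % d
∃-multiple≡-mod c d gcd≡1 m with ∃-inverse-mod c d gcd≡1
... | u , uc≡1 = (m * u) % d , m%n<n (m * u) d , (begin
  ((m * u) % d * c) % d ≡⟨ %-cong-*ʳ c d (m%n%n≡m%n (m * u) d) ⟩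
  (m * u * c) % d       ≡⟨ cong (_% d) (trans (*-assoc m u c) (*-comm m (u * c))) ⟩
  (u * c * m) % d       ≡⟨ %-cong-*ʳ m d uc≡1 ⟩
  (1 * m) % d           ≡⟨ cong (_% d) (*-identityˡ m) ⟩
  m % d                 ∎)
  where open ≡-Reasoning

%≡%∧≤⇒∃+* : ∀ {m n} d .{{_ : NonZero d}} → m % d ≡ n % d → m ≤ n → ∃[ k ] n ≡ m + k * d
%≡%∧≤⇒∃+* {m} {n} d m%d≡n%d m≤n = n / d ∸ m / d , (begin
  n                                         ≡⟨ m+[n∸m]≡n m≤n ⟨
  m + (n ∸ m)                               ≡⟨ cong (m +_) n∸m≡ ⟩
  m + (n / d ∸ m / d) * d                   ∎)
  where
  open ≡-Reasoning
  n∸m≡ : n ∸ m ≡ (n / d ∸ m / d) * d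
  n∸m≡ = begin
    n ∸ m                                         ≡⟨ cong₂ _∸_ (m≡m%n+[m/n]*n n d) (m≡m%n+[m/n]*n m d) ⟩
    (n % d + n / d * d) ∸ (m % d + m / d * d)     ≡⟨ cong (λ t → (t + n / d * d) ∸ (m % d + m / d * d)) m%d≡n%d ⟨
    (m % d + n / d * d) ∸ (m % d + m / d * d)     ≡⟨ [m+n]∸[m+o]≡n∸o (m % d) (n / d * d) (m / d * d) ⟩
    n / d * d ∸ m / d * d                         ≡⟨ *-distribʳ-∸ d (n / d) (m / d) ⟨
    (n / d ∸ m / d) * d                           ∎

congruent-multiple≤ : ∀ {x c m} d .{{_ : NonZero d}} → x < d → (x * c) % d ≡ m % d → pred d * c < m + d → x * c ≤ m
congruent-multiple≤ {x} {c} {m} d x<d xc≡m bound =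
  ≮⇒≥ λ m<xc → impossible (%≡%∧≤⇒∃+* d (sym xc≡m) (<⇒≤ m<xc)) m<xc
  where
  open ≤-Reasoning
  impossible : (∃[ k ] x * c ≡ m + k * d) → m < x * c → ⊥
  impossible (zero  , xc≡m+0)  m<xc = <-irrefl (sym (trans xc≡m+0 (+-identityʳ m))) m<xc
  impossible (suc k , xc≡m+kd) _    = <⇒≱ bound (begin
    m + d          ≤⟨ +-monoʳ-≤ m (m≤m+n d (k * d)) ⟩
    m + suc k * d  ≡⟨ xc≡m+kd ⟨
    x * c          ≤⟨ *-monoˡ-≤ c (<⇒≤pred x<d) ⟩
    pred d * c     ∎)

∃-small-coefficient : ∀ c d .{{_ : NonZero d}} → gcd c d ≡ 1 → ∀ m → pred d * c < m + d →
                      ∃[ x ] ∃[ k ] x < d × m ≡ x * c + k * d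
∃-small-coefficient c d gcd≡1 m bound =
  let x , x<d , xc≡m = ∃-multiple≡-mod c d gcd≡1 m
      k , m≡xc+kd = %≡%∧≤⇒∃+* d xc≡m (congruent-multiple≤ d x<d xc≡m bound)
  in x , k , x<d , m≡xc+kd

Representable : ℕ → ℕ → ℕ → Set
Representable b c m = ∃[ y ] ∃[ z ] m ≡ y * b + z * c

sylvester : ∀ b c .{{_ : NonZero b}} → gcd b c ≡ 1 → ∀ m → b * c < m + b + c → Representable b c m
sylvester b c gcd≡1 m bc<m+b+c =
  let x , k , _ , m≡xc+kb = ∃-small-coefficient c b (trans (gcd-comm c b) gcd≡1) m pred[b]*c<m+b
  in k , x , trans m≡xc+kb (+-comm (x * c) (k * b))
  where
  pred[b]*c<m+b : pred b * c < m + b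
  pred[b]*c<m+b = +-cancelʳ-< c (pred b * c) (m + b) (begin-strict
    pred b * c + c       ≡⟨ +-comm (pred b * c) c ⟩
    suc (pred b) * c     ≡⟨ cong (_* c) (suc-pred b) ⟩
    b * c                <⟨ bc<m+b+c ⟩
    m + b + c            ∎)
    where open ≤-Reasoning

sylvester-bound : ∀ b c {m} .{{_ : NonZero b}} .{{_ : NonZero c}} →
                  (b ∸ 1) * (c ∸ 1) ≤ m → b * c < m + b + c
sylvester-bound (suc b′) (suc c′) {m} b′c′≤m = begin
  suc (suc b′ * suc c′)        ≡⟨ identity b′ c′ ⟩
  b′ * c′ + (suc b′ + suc c′)  ≤⟨ +-monoˡ-≤ (suc b′ + suc c′) b′c′≤m ⟩
  m + (suc b′ + suc c′)        ≡⟨ +-assoc m (suc b′) (suc c′) ⟨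
  m + suc b′ + suc c′          ∎
  where
  open ≤-Reasoning
  identity : ∀ b′ c′ → suc (suc b′ * suc c′) ≡ b′ * c′ + (suc b′ + suc c′)
  identity = solve-∀

frobenius₃-bound₁ : ∀ q r s {a} .{{_ : NonZero q}} .{{_ : NonZero r}} .{{_ : NonZero s}} →
                    2 * q * r * s < a + (q * s + q * r + r * s) → pred q * (r * s) < a + q
frobenius₃-bound₁ (suc q′) (suc r′) (suc s′) {a} bound =
  +-cancelʳ-< Y (q′ * (r * s)) (a + q) (begin-strict
    q′ * (r * s) + Y               ≤⟨ m≤m+n (q′ * (r * s) + Y) (q * r′ * s′) ⟩
    q′ * (r * s) + Y + q * r′ * s′ ≡⟨ slack q′ r′ s′ ⟩
    2 * q * r * s + q              <⟨ +-monoˡ-< q bound ⟩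
    a + Y + q                      ≡⟨ +-assoc a Y q ⟩
    a + (Y + q)                    ≡⟨ cong (a +_) (+-comm Y q) ⟩
    a + (q + Y)                    ≡⟨ +-assoc a q Y ⟨
    a + q + Y                      ∎)
  where
  open ≤-Reasoning
  q = suc q′
  r = suc r′
  s = suc s′
  Y = q * s + q * r + r * s
  slack : ∀ q′ r′ s′ → q′ * (suc r′ * suc s′) + (suc q′ * suc s′ + suc q′ * suc r′ + suc r′ * suc s′) + suc q′ * r′ * s′
                       ≡ 2 * suc q′ * suc r′ * suc s′ + suc q′
  slack = solve-∀

frobenius₃-bound₂ : ∀ q r s {a x k} .{{_ : NonZero q}} →
                    2 * q * r * s < a + (q * s + q * r + r * s) →
                    x < q → a ≡ x * (r * s) + k * q → r * s < k + r + s
frobenius₃-bound₂ q@(suc q′) r s {a} {x} {k} bound x<q a≡x·rs+k·q =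
  *-cancelˡ-< q (r * s) (k + r + s) (+-cancelˡ-< (q * (r * s)) (q * (r * s)) (q * (k + r + s)) (begin-strict
    q * (r * s) + q * (r * s)      ≡⟨ double q r s ⟩
    2 * q * r * s                  <⟨ bound ⟩
    a + Y                          ≡⟨ cong (_+ Y) a≡x·rs+k·q ⟩
    x * (r * s) + k * q + Y        ≤⟨ +-monoˡ-≤ Y (+-monoˡ-≤ (k * q) (*-monoˡ-≤ (r * s) (<⇒≤pred x<q))) ⟩
    q′ * (r * s) + k * q + Y       ≡⟨ identity q′ r s k ⟩
    q * (r * s) + q * (k + r + s)  ∎))
  where
  open ≤-Reasoning
  Y = q * s + q * r + r * s
  double : ∀ q r s → q * (r * s) + q * (r * s) ≡ 2 * q * r * s
  double = solve-∀
  identity : ∀ q′ r s k → q′ * (r * s) + k * suc q′ + (suc q′ * s + suc q′ * r + r * s)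
                          ≡ suc q′ * (r * s) + suc q′ * (k + r + s)
  identity = solve-∀

frobenius₃ : ∀ q r s .{{_ : NonZero q}} .{{_ : NonZero r}} .{{_ : NonZero s}} →
             gcd (r * s) q ≡ 1 → gcd r s ≡ 1 →
             ∀ a → 2 * q * r * s < a + (q * s + q * r + r * s) →
             ∃[ x ] ∃[ y ] ∃[ z ] a ≡ x * (r * s) + y * (q * r) + z * (q * s)
frobenius₃ q r s gcd[rs,q]≡1 gcd[r,s]≡1 a bound =
  let x , k , x<q , a≡x·rs+k·q = ∃-small-coefficient (r * s) q gcd[rs,q]≡1 a (frobenius₃-bound₁ q r s bound)
      y , z , k≡y·r+z·s = sylvester r s gcd[r,s]≡1 k (frobenius₃-bound₂ q r s bound x<q a≡x·rs+k·q)
  in x , y , z , (begin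
    a                                       ≡⟨ a≡x·rs+k·q ⟩
    x * (r * s) + k * q                     ≡⟨ cong (λ t → x * (r * s) + t * q) k≡y·r+z·s ⟩
    x * (r * s) + (y * r + z * s) * q       ≡⟨ distribute x y z q r s ⟩
    x * (r * s) + y * (q * r) + z * (q * s) ∎)
  where
  open ≡-Reasoning
  distribute : ∀ x y z q r s → x * (r * s) + (y * r + z * s) * q ≡ x * (r * s) + y * (q * r) + z * (q * s)
  distribute = solve-∀

m∸n+1≤o⇒m<o+n : ∀ {m n o} → m ∸ n + 1 ≤ o → m < o + n
m∸n+1≤o⇒m<o+n {m} {n} {o} le = begin-strict
  m                 ≤⟨ m≤n+m∸n m n ⟩
  n + (m ∸ n)       <⟨ +-monoʳ-< n (subst (_≤ o) (+-comm (m ∸ n) 1) le) ⟩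
  n + o             ≡⟨ +-comm n o ⟩
  o + n             ∎
  where open ≤-Reasoning

gcd[qs,qr,rs]≡1⇒gcd[rs,q]≡1 : ∀ q r s → gcd (gcd (q * s) (q * r)) (r * s) ≡ 1 → gcd (r * s) q ≡ 1
gcd[qs,qr,rs]≡1⇒gcd[rs,q]≡1 q r s gcd≡1 = ∣1⇒≡1 (subst (gcd (r * s) q ∣_) gcd≡1
  (gcd-greatest (gcd-greatest (∣-trans g∣q (m∣m*n s)) (∣-trans g∣q (m∣m*n r))) (gcd[m,n]∣m (r * s) q)))
  where
  g∣q = gcd[m,n]∣n (r * s) q

-- Placed bricks and the cells they cover

+-<ᵇ : ∀ a m n → (a + m <ᵇ a + n) ≡ (m <ᵇ n)
+-<ᵇ zero    m n = refl
+-<ᵇ (suc a) m n = +-<ᵇ a m n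

≤ᵇ≡<ᵇsuc : ∀ m n → (m ≤ᵇ n) ≡ (m <ᵇ suc n)
≤ᵇ≡<ᵇsuc zero    n = refl
≤ᵇ≡<ᵇsuc (suc m) n = refl

+-≤ᵇ : ∀ a m n → (a + m ≤ᵇ a + n) ≡ (m ≤ᵇ n)
+-≤ᵇ a m n = begin
  a + m ≤ᵇ a + n       ≡⟨ ≤ᵇ≡<ᵇsuc (a + m) (a + n) ⟩
  a + m <ᵇ suc (a + n) ≡⟨ cong (a + m <ᵇ_) (sym (+-suc a n)) ⟩
  a + m <ᵇ a + suc n   ≡⟨ +-<ᵇ a m (suc n) ⟩
  m <ᵇ suc n           ≡⟨ sym (≤ᵇ≡<ᵇsuc m n) ⟩
  m ≤ᵇ n               ∎
  where open ≡-Reasoning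

<⇒<ᵇ≡true : ∀ {m n} → m < n → (m <ᵇ n) ≡ true
<⇒<ᵇ≡true {zero}  {suc n} _         = refl
<⇒<ᵇ≡true {suc m} {suc n} (s≤s m<n) = <⇒<ᵇ≡true m<n

≤⇒<ᵇ≡false : ∀ {m n} → n ≤ m → (m <ᵇ n) ≡ false
≤⇒<ᵇ≡false {m}     {zero}  z≤n       = refl
≤⇒<ᵇ≡false {suc m} {suc n} (s≤s n≤m) = ≤⇒<ᵇ≡false n≤m

<⇒≤ᵇ≡false : ∀ {m n} → n < m → (m ≤ᵇ n) ≡ false
<⇒≤ᵇ≡false {suc m} (s≤s n≤m) = ≤⇒<ᵇ≡false n≤m

∧-interchange : ∀ a b c d → a ∧ (b ∧ (c ∧ d)) ≡ c ∧ (d ∧ (a ∧ b))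
∧-interchange a b c d = begin
  a ∧ (b ∧ (c ∧ d)) ≡⟨ sym (∧-assoc a b (c ∧ d)) ⟩
  (a ∧ b) ∧ (c ∧ d) ≡⟨ ∧-comm (a ∧ b) (c ∧ d) ⟩
  (c ∧ d) ∧ (a ∧ b) ≡⟨ ∧-assoc c d (a ∧ b) ⟩
  c ∧ (d ∧ (a ∧ b)) ∎
  where open ≡-Reasoning

shiftˣ : ℕ → Placed → Placed
shiftˣ a b = place (a + x b) (y b) (w b) (h b)

transpose : Placed → Placed
transpose b = place (y b) (x b) (h b) (w b)

covers-origin : ∀ {m n i j} → i < m → j < n → covers (place 0 0 m n) i j ≡ true
covers-origin i<m j<n = cong₂ _∧_ (<⇒<ᵇ≡true i<m) (<⇒<ᵇ≡true j<n)

covers-beyond : ∀ b {i} j → x b + w b ≤ i → covers b i j ≡ false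
covers-beyond b {i} j x+w≤i rewrite ≤⇒<ᵇ≡false x+w≤i = ∧-zeroʳ (x b ≤ᵇ i)

covers-shiftˣ-< : ∀ {a i} b j → i < a → covers (shiftˣ a b) i j ≡ false
covers-shiftˣ-< {a} b j i<a rewrite <⇒≤ᵇ≡false (≤-trans i<a (m≤m+n a (x b))) = refl

covers-shiftˣ : ∀ a b i j → covers (shiftˣ a b) (a + i) j ≡ covers b i j
covers-shiftˣ a b i j
  rewrite +-≤ᵇ a (x b) i | +-assoc a (x b) (w b) | +-<ᵇ a i (x b + w b) = refl

covers-transpose : ∀ b i j → covers (transpose b) i j ≡ covers b j i
covers-transpose b i j = ∧-interchange (y b ≤ᵇ i) (i <ᵇ y b + h b) (x b ≤ᵇ j) (j <ᵇ x b + w b)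

coverCount-++ : ∀ bs bs′ i j → coverCount (bs ++ bs′) i j ≡ coverCount bs i j + coverCount bs′ i j
coverCount-++ bs bs′ i j = trans (cong sum (map-++ count bs bs′)) (sum-++ (map count bs) (map count bs′))
  where
  count : Placed → ℕ
  count b = if covers b i j then 1 else 0

coverCount-none : ∀ {bs i j} → All (λ b → covers b i j ≡ false) bs → coverCount bs i j ≡ 0
coverCount-none []         = refl
coverCount-none (eq ∷ eqs) rewrite eq = coverCount-none eqs

coverCount-map : ∀ f {i j i′ j′} → (∀ b → covers (f b) i j ≡ covers b i′ j′) →
                 ∀ bs → coverCount (map f bs) i j ≡ coverCount bs i′ j′
coverCount-map f eq []       = refl
coverCount-map f eq (b ∷ bs) = cong₂ _+_ (cong (λ t → if t then 1 else 0) (eq b)) (coverCount-map f eq bs)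

isCopyOf-transpose : ∀ {u v b} → IsCopyOf u v b → IsCopyOf u v (transpose b)
isCopyOf-transpose (inj₁ (w≡u , h≡v)) = inj₂ (h≡v , w≡u)
isCopyOf-transpose (inj₂ (w≡v , h≡u)) = inj₁ (h≡u , w≡v)

-- Tilings by (p × q) and (r × s) bricks

module Tilings (p q r s : ℕ) where

  Tiles : ℕ → ℕ → Set
  Tiles m n = Tileable m n p q r s

  Admissible : ℕ → ℕ → Placed → Set
  Admissible m n b = (IsCopyOf p q b ⊎ IsCopyOf r s b) × Inside m n b

  tiles-empty : ∀ {n} → Tiles 0 n
  tiles-empty = [] , [] , λ i j ()

  tiles-brick : ∀ {m n} → IsCopyOf p q (place 0 0 m n) ⊎ IsCopyOf r s (place 0 0 m n) → Tiles m n
  tiles-brick copy = place 0 0 _ _ ∷ [] , (copy , ≤-refl , ≤-refl) ∷ [] ,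
    λ i j i<m j<n → cong (λ t → (if t then 1 else 0) + 0) (covers-origin i<m j<n)

  admissible-transpose : ∀ {m n b} → Admissible m n b → Admissible n m (transpose b)
  admissible-transpose {b = b} (inj₁ copy , inside) = inj₁ (isCopyOf-transpose {p} {q} {b} copy) , Prod.swap inside
  admissible-transpose {b = b} (inj₂ copy , inside) = inj₂ (isCopyOf-transpose {r} {s} {b} copy) , Prod.swap inside

  tiles-transpose : ∀ {m n} → Tiles m n → Tiles n m
  tiles-transpose (bs , admissible , cover) =
    map transpose bs ,
    map⁺ (All.map admissible-transpose admissible) ,
    λ i j i<n j<m → trans (coverCount-map transpose (λ b → covers-transpose b i j) bs) (cover j i j<m i<n)

  tiles-beside : ∀ {m m′ n} → Tiles m n → Tiles m′ n → Tiles (m + m′) n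
  tiles-beside {m} {m′} {n} (bs , admissible , cover) (bs′ , admissible′ , cover′) =
    bs ++ bs″ , ++⁺ (All.map widen admissible) (map⁺ (All.map shift admissible′)) , cover″
    where
    bs″ = map (shiftˣ m) bs′

    widen : ∀ {b} → Admissible m n b → Admissible (m + m′) n b
    widen (copy , x+w≤m , y+h≤n) = copy , ≤-trans x+w≤m (m≤m+n m m′) , y+h≤n

    shift : ∀ {b} → Admissible m′ n b → Admissible (m + m′) n (shiftˣ m b)
    shift {b} (copy , x+w≤m′ , y+h≤n) =
      copy , subst (_≤ m + m′) (sym (+-assoc m (x b) (w b))) (+-monoʳ-≤ m x+w≤m′) , y+h≤n

    cover-left : ∀ i j → i < m → j < n → coverCount (bs ++ bs″) i j ≡ 1
    cover-left i j i<m j<n = begin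
      coverCount (bs ++ bs″) i j           ≡⟨ coverCount-++ bs bs″ i j ⟩
      coverCount bs i j + coverCount bs″ i j ≡⟨ cong₂ _+_ (cover i j i<m j<n) (coverCount-none
                                                  (map⁺ (All.universal (λ b → covers-shiftˣ-< b j i<m) bs′))) ⟩
      1                                    ∎
      where open ≡-Reasoning

    cover-right : ∀ k j → k < m′ → j < n → coverCount (bs ++ bs″) (m + k) j ≡ 1
    cover-right k j k<m′ j<n = begin
      coverCount (bs ++ bs″) (m + k) j               ≡⟨ coverCount-++ bs bs″ (m + k) j ⟩
      coverCount bs (m + k) j + coverCount bs″ (m + k) j
        ≡⟨ cong₂ _+_ (coverCount-none (All.map (λ { {b} (_ , x+w≤m , _) → covers-beyond b j (≤-trans x+w≤m (m≤m+n m k)) }) admissible))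
                     (coverCount-map (shiftˣ m) (λ b → covers-shiftˣ m b k j) bs′) ⟩
      coverCount bs′ k j                             ≡⟨ cover′ k j k<m′ j<n ⟩
      1                                              ∎
      where open ≡-Reasoning

    cover″ : ∀ i j → i < m + m′ → j < n → coverCount (bs ++ bs″) i j ≡ 1
    cover″ i j i<m+m′ j<n with i <? m
    ... | yes i<m = cover-left i j i<m j<n
    ... | no  i≮m = subst (λ i → coverCount (bs ++ bs″) i j ≡ 1) m+[i∸m]≡i
      (cover-right (i ∸ m) j (+-cancelˡ-< m (i ∸ m) m′ (subst (_< m + m′) (sym m+[i∸m]≡i) i<m+m′)) j<n)
      where
      m+[i∸m]≡i : m + (i ∸ m) ≡ i
      m+[i∸m]≡i = m+[n∸m]≡n (≮⇒≥ i≮m)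

  tiles-above : ∀ {m n n′} → Tiles m n → Tiles m n′ → Tiles m (n + n′)
  tiles-above t t′ = tiles-transpose (tiles-beside (tiles-transpose t) (tiles-transpose t′))

  tiles-repeatʰ : ∀ {m n} k → Tiles m n → Tiles (k * m) n
  tiles-repeatʰ zero    t = tiles-empty
  tiles-repeatʰ (suc k) t = tiles-beside t (tiles-repeatʰ k t)

  tiles-repeatᵛ : ∀ {m n} k → Tiles m n → Tiles m (k * n)
  tiles-repeatᵛ k t = tiles-transpose (tiles-repeatʰ k (tiles-transpose t))

  tiles-column : ∀ {m n n′ a} .{{_ : NonZero n}} .{{_ : NonZero n′}} → gcd n n′ ≡ 1 →
                 (n ∸ 1) * (n′ ∸ 1) ≤ a → Tiles m n → Tiles m n′ → Tiles m a
  tiles-column {n = n} {n′} {a} gcd≡1 bound t t′ =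
    let k , k′ , a≡ = sylvester n n′ gcd≡1 a (sylvester-bound n n′ bound)
    in subst (Tiles _) (sym a≡) (tiles-above (tiles-repeatᵛ k t) (tiles-repeatᵛ k′ t′))

  tiles-repeatʰ′ : ∀ {m n} k → Tiles m n → Tiles (m * k) n
  tiles-repeatʰ′ {m} {n} k t = subst (λ m → Tiles m n) (*-comm k m) (tiles-repeatʰ k t)

  tiles-q×p : Tiles q p
  tiles-q×p = tiles-brick (inj₁ (inj₂ (refl , refl)))

  tiles-r×s : Tiles r s
  tiles-r×s = tiles-brick (inj₂ (inj₁ (refl , refl)))

  tiles-s×r : Tiles s r
  tiles-s×r = tiles-brick (inj₂ (inj₂ (refl , refl)))

  tiles-r*s : ∀ {a} .{{_ : NonZero r}} .{{_ : NonZero s}} → gcd r s ≡ 1 → (r ∸ 1) * (s ∸ 1) ≤ a → Tiles (r * s) a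
  tiles-r*s gcd≡1 bound = tiles-column gcd≡1 bound (tiles-repeatʰ r tiles-s×r) (tiles-repeatʰ′ s tiles-r×s)

  tiles-q*r : ∀ {a} .{{_ : NonZero p}} .{{_ : NonZero s}} → gcd p s ≡ 1 → (p ∸ 1) * (s ∸ 1) ≤ a → Tiles (q * r) a
  tiles-q*r gcd≡1 bound = tiles-column gcd≡1 bound (tiles-repeatʰ′ r tiles-q×p) (tiles-repeatʰ q tiles-r×s)

  tiles-q*s : ∀ {a} .{{_ : NonZero p}} .{{_ : NonZero r}} → gcd p r ≡ 1 → (p ∸ 1) * (r ∸ 1) ≤ a → Tiles (q * s) a
  tiles-q*s gcd≡1 bound = tiles-column gcd≡1 bound (tiles-repeatʰ′ s tiles-q×p) (tiles-repeatʰ q tiles-s×r)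

corollary1p3 : (a₁ a₂ p q r s : ℕ) →
    2 ≤ a₁ → 2 ≤ a₂ → 2 ≤ p → 2 ≤ q → 2 ≤ r → 2 ≤ s →
    r < s →
    gcd (gcd (q * s) (q * r)) (r * s) ≡ 1 →
    gcd p r ≡ 1 → gcd p s ≡ 1 → gcd r s ≡ 1 →
    ((2 * q * r * s) ∸ (q * s + q * r + r * s) + 1) ⊔ ((p ∸ 1) * (s ∸ 1)) ⊔ ((r ∸ 1) * (s ∸ 1)) ≤ a₁ →
    ((2 * q * r * s) ∸ (q * s + q * r + r * s) + 1) ⊔ ((p ∸ 1) * (s ∸ 1)) ⊔ ((r ∸ 1) * (s ∸ 1)) ≤ a₂ →
    Tileable a₁ a₂ p q r s
corollary1p3 a₁ a₂ p q r s _ _ 2≤p 2≤q 2≤r 2≤s r<s gcd[qs,qr,rs]≡1 gcd[p,r]≡1 gcd[p,s]≡1 gcd[r,s]≡1 bound₁ bound₂ =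
  let x , y , z , a₁≡ = frobenius₃ q r s (gcd[qs,qr,rs]≡1⇒gcd[rs,q]≡1 q r s gcd[qs,qr,rs]≡1) gcd[r,s]≡1 a₁
                          (m∸n+1≤o⇒m<o+n F≤a₁)
  in subst (λ m → Tiles m a₂) (sym a₁≡)
       (tiles-beside (tiles-beside (tiles-repeatʰ x (tiles-r*s gcd[r,s]≡1 C≤a₂))
                                   (tiles-repeatʰ y (tiles-q*r gcd[p,s]≡1 B≤a₂)))
                     (tiles-repeatʰ z (tiles-q*s gcd[p,r]≡1 [p-1][r-1]≤a₂)))
  where
  open Tilings p q r s
  instance
    p-nonZero : NonZero p
    p-nonZero = >-nonZero (<-trans z<s 2≤p)
    q-nonZero : NonZero q
    q-nonZero = >-nonZero (<-trans z<s 2≤q)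
    r-nonZero : NonZero r
    r-nonZero = >-nonZero (<-trans z<s 2≤r)
    s-nonZero : NonZero s
    s-nonZero = >-nonZero (<-trans z<s 2≤s)
  F B C : ℕ
  F = 2 * q * r * s ∸ (q * s + q * r + r * s) + 1
  B = (p ∸ 1) * (s ∸ 1)
  C = (r ∸ 1) * (s ∸ 1)
  F≤a₁ : F ≤ a₁
  F≤a₁ = m⊔n≤o⇒m≤o F B (m⊔n≤o⇒m≤o (F ⊔ B) C bound₁)
  B≤a₂ : B ≤ a₂
  B≤a₂ = m⊔n≤o⇒n≤o F B (m⊔n≤o⇒m≤o (F ⊔ B) C bound₂)
  C≤a₂ : C ≤ a₂
  C≤a₂ = m⊔n≤o⇒n≤o (F ⊔ B) C bound₂
  [p-1][r-1]≤a₂ : (p ∸ 1) * (r ∸ 1) ≤ a₂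
  [p-1][r-1]≤a₂ = ≤-trans (*-monoʳ-≤ (p ∸ 1) (∸-monoˡ-≤ 1 (<⇒≤ r<s))) B≤a₂
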